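{- Let $\pi'$ be a dominant permutation of $\{2,3,\dots,n\}$, and let $1\pi'\in S_n$ be the permutation with $1\pi'(1)=1$ and $1\pi'(i)=\pi'(i)$ for $i\ge 2$. Then $Y_{1\pi'}$ is a toric variety with respect to the $T^{2n-1}$-action.
   Context: Matrices in $M_n$ have entries indexed by (row, column), rows numbered from top to bottom. The permutation matrix of $\pi$ has $(i,j)$ entry $1$ if $\pi(j)=i$ and $0$ otherwise. $B_\pm$ denote the invertible upper/lower triangular matrices, and $\overline{X_\pi}$ is the Zariski closure of $B_-\pi B_+$ in $M_n$. The diagram of $\pi$ is $D(\pi)=\{(\pi_j,i): i<j,\ \pi_i>\pi_j\}$. The dominant piece $\mathrm{dom}(\pi)$ is the edge-connected component of $D(\pi)$ containing $(1,1)$, or empty if $(1,1)\notin D(\pi)$. Let $NW(\pi)=\{(i,j): \exists (a,b)\in D(\pi),\ i\le a,\ j\le b\}$ and $L(\pi)=NW(\pi)\setminus \mathrm{dom}(\pi)$. $Y_\pi$ is the image of $\overline{X_\pi}$ under the projection onto the coordinates in $L(\pi)$. The torus of pairs $(A,B)$ of invertible diagonal matrices acts by $(A,B)\cdot M=AMB^{ -1}$, inducing an action on $Y_\pi$. Modulo the trivially acting scalars $\{(aI,aI)\}$ this gives the torus $T^{2n-1}$. $Y_\pi$ is called toric with respect to this action if it contains a dense orbit. $\pi'$ dominant means that the diagram $D(1\pi')$ is either empty or a Young diagram of partition shape whose northwest-most box is $(2,2)$. -}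

module Defs where

open import Level using (Level; _⊔_) renaming (suc to lsuc)
open import Data.Nat using (ℕ; zero; suc)
open import Data.Fin using (Fin; toℕ; _<_; _≤_)
open import Data.Fin.Permutation using (Permutation′; _⟨$⟩ʳ_; lift₀)
open import Data.Product using (Σ; ∃; _×_; _,_)
open import Relation.Binary.PropositionalEquality using (_≡_)
open import Relation.Nullary using (¬_; Dec; yes; no)
open import Algebra.Bundles using (CommutativeRing)
import Data.Fin as F
import Data.Nat as ℕ

-- Algebraically closed fields of characteristic zero (stand-in for ℂ)

module RingOps {c ℓ} (R : CommutativeRing c ℓ) where
  open CommutativeRing R
  pow : Carrier → ℕ → Carrier
  pow x zero    = 1#
  pow x (suc k) = x * pow x k
  sumF : ∀ {k} → (Fin k → Carrier) → Carrier
  sumF {zero}  f = 0#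
  sumF {suc k} f = f F.zero + sumF (λ i → f (F.suc i))
  natC : ℕ → Carrier
  natC zero    = 0#
  natC (suc k) = 1# + natC k

record ACF₀ (c ℓ : Level) : Set (lsuc (c ⊔ ℓ)) where
  field
    cring : CommutativeRing c ℓ
  open CommutativeRing cring
  open RingOps cring
  field
    nontrivial : ¬ (1# ≈ 0#)
    inverse    : ∀ x → ¬ (x ≈ 0#) → ∃ λ y → x * y ≈ 1#
    charZero   : ∀ k → ¬ (natC (suc k) ≈ 0#)
    algClosed  : ∀ k (a : Fin (suc k) → Carrier) →
                 ∃ λ x → pow x (suc k) + sumF (λ i → a i * pow x (toℕ i)) ≈ 0#

-- Combinatorics of permutations (indices are 0-based: Fin n ↔ {1..n})

Pos : ℕ → Set
Pos n = Fin n × Fin n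

-- D(π) = {(π_j, i) : i < j, π_i > π_j}  (row, column)
Diagram : ∀ {n} → Permutation′ n → Pos n → Set
Diagram {n} π (r , c) =
  Σ (Fin n) λ j → c < j × (π ⟨$⟩ʳ j) < (π ⟨$⟩ʳ c) × r ≡ π ⟨$⟩ʳ j

data Adj {n} : Pos n → Pos n → Set where
  right : ∀ r c c′ → suc (toℕ c) ≡ toℕ c′ → Adj (r , c) (r , c′)
  left  : ∀ r c c′ → suc (toℕ c′) ≡ toℕ c → Adj (r , c) (r , c′)
  down  : ∀ r r′ c → suc (toℕ r) ≡ toℕ r′ → Adj (r , c) (r′ , c)
  up    : ∀ r r′ c → suc (toℕ r′) ≡ toℕ r → Adj (r , c) (r′ , c)

data Reach {n} (S : Pos n → Set) : Pos n → Pos n → Set where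
  here : ∀ {x} → S x → Reach S x x
  step : ∀ {x y z} → Reach S x y → Adj y z → S z → Reach S x z

-- dom(π): component of D(π) containing (1,1) (empty if (1,1) ∉ D(π))
Dom : ∀ {n} → Permutation′ (suc n) → Pos (suc n) → Set
Dom π x = Reach (Diagram π) (F.zero , F.zero) x

NW : ∀ {n} → Permutation′ n → Pos n → Set
NW {n} π (i , j) = Σ (Pos n) λ { (a , b) → Diagram π (a , b) × i ≤ a × j ≤ b }

Lset : ∀ {n} → Permutation′ (suc n) → Pos (suc n) → Set
Lset π x = NW π x × ¬ Dom π x

YoungFrom22 : ∀ {n} → (Pos n → Set) → Set
YoungFrom22 {n} S =
  (Σ (Pos n) λ { (r , c) → toℕ r ≡ 1 × toℕ c ≡ 1 × S (r , c) }) ×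
  (∀ r c → S (r , c) → (1 ℕ.≤ toℕ r) × (1 ℕ.≤ toℕ c)) ×
  (∀ r c r′ c′ → S (r , c) → 1 ℕ.≤ toℕ r′ → 1 ℕ.≤ toℕ c′ →
     r′ ≤ r → c′ ≤ c → S (r′ , c′))

-- π′ (a permutation of {2..n}, encoded as a permutation σ of Fin (n-1))
-- is dominant iff D(1π′) is empty or a Young diagram with NW box (2,2)
DominantShifted : ∀ {m} → Permutation′ m → Set
DominantShifted σ = (∀ x → ¬ Diagram (lift₀ σ) x) ⊎′ YoungFrom22 (Diagram (lift₀ σ))
  where
  open import Data.Sum using () renaming (_⊎_ to _⊎′_)

module Geometry {c ℓ} (K : ACF₀ c ℓ) where
  open ACF₀ K
  open CommutativeRing cring
  open RingOps cring

  data Poly (I : Set) : Set c where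
    var  : I → Poly I
    con  : Carrier → Poly I
    _⊕_  : Poly I → Poly I → Poly I
    _⊛_  : Poly I → Poly I → Poly I

  eval : ∀ {I} → Poly I → (I → Carrier) → Carrier
  eval (var i) x = x i
  eval (con a) x = a
  eval (p ⊕ q) x = eval p x + eval q x
  eval (p ⊛ q) x = eval p x * eval q x

  closure : ∀ {I} → ((I → Carrier) → Set (c ⊔ ℓ)) → (I → Carrier) → Set (c ⊔ ℓ)
  closure {I} S x = ∀ (p : Poly I) → (∀ y → S y → eval p y ≈ 0#) → eval p x ≈ 0#

  Mat : ℕ → Set c
  Mat n = Fin n → Fin n → Carrier

  _·_ : ∀ {n} → Mat n → Mat n → Mat n
  (A · B) i j = sumF (λ k → A i k * B k j)

  permMat : ∀ {n} → Permutation′ n → Mat n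
  permMat π i j with π ⟨$⟩ʳ j F.≟ i
  ... | yes _ = 1#
  ... | no  _ = 0#

  UpperInv : ∀ {n} → Mat n → Set ℓ
  UpperInv {n} B = (∀ i j → j < i → B i j ≈ 0#) × (∀ i → ¬ (B i i ≈ 0#))

  LowerInv : ∀ {n} → Mat n → Set ℓ
  LowerInv {n} B = (∀ i j → i < j → B i j ≈ 0#) × (∀ i → ¬ (B i i ≈ 0#))

  Cell : ∀ {n} → Permutation′ n → (Pos n → Carrier) → Set (c ⊔ ℓ)
  Cell {n} π M = Σ (Mat n) λ L → Σ (Mat n) λ U →
    LowerInv L × UpperInv U × (∀ i j → M (i , j) ≈ ((L · permMat π) · U) i j)

  -- Y_π, realised inside M_n as the coordinate subspace K^{L(π)}
  -- (coordinates outside L(π) set to 0): image of the projection of the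
  -- closure of B₋ π B₊ onto the coordinates in L(π)
  Y : ∀ {n} → Permutation′ (suc n) → (Pos (suc n) → Carrier) → Set (c ⊔ ℓ)
  Y π z = Σ _ λ M → closure (Cell π) M ×
    (∀ x → Lset π x → z x ≈ M x) × (∀ x → ¬ Lset π x → z x ≈ 0#)

  -- orbit of z under (A,B)·M = A M B⁻¹ with A, B invertible diagonal
  -- (written with C = B⁻¹, which ranges over the same set)
  Orbit : ∀ {n} → (Pos n → Carrier) → (Pos n → Carrier) → Set (c ⊔ ℓ)
  Orbit {n} z w = Σ (Fin n → Carrier) λ a → Σ (Fin n → Carrier) λ b →
    (∀ i → ¬ (a i ≈ 0#)) × (∀ i → ¬ (b i ≈ 0#)) ×
    (∀ i j → w (i , j) ≈ (a i * z (i , j)) * b j)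

  Toric : ∀ {n} → Permutation′ (suc n) → Set (c ⊔ ℓ)
  Toric π = Σ _ λ y → Y π y ×
    (∀ w → Orbit y w → Y π w) × (∀ w → Y π w → closure (Orbit y) w)

module Submission where

-- Write π = 1π′ (= lift₀ σ).  Since π fixes the first index, (1,1) ∉ D(π),
-- so dom(π) is empty and L(π) = NW(π).  Dominance of π′ means that no pivot
-- (π k, k), k > 1, of the permutation matrix lies weakly northwest of a box
-- of NW(π); hence for lower/upper triangular L, U the entry (i,j) of
-- L P_π U, for (i,j) ∈ NW(π), is the single product L i 1 · U 1 j.  So the
-- points of B₋ π B₊ projected to NW(π) are exactly the "rank one" matrices
-- (a_i b_j) supported on NW(π).  The generic point y is the indicator matrix
-- of NW(π): its orbit consists of the (a_i b_j) with all a_i, b_j ≠ 0, which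
-- lie in Y_π; and conversely a polynomial vanishing on that orbit vanishes,
-- after substituting x_{ij} ↦ a_i b_j, on the whole torus, hence on all of
-- K^{2n} (an infinite field: char 0), hence on every cell point and so on Y_π.

open import Defs
open import Level using (Level)
open import Data.Nat using (ℕ; suc)
open import Data.Fin.Permutation using (Permutation′; lift₀)

open import Data.Nat as ℕ using (zero; z≤n; s≤s)
import Data.Nat.Properties as ℕP
open import Data.Fin as F using (Fin)
import Data.Fin.Properties as FP
open import Data.Fin.Permutation using (_⟨$⟩ʳ_)
open import Data.List using (List; []; _∷_; length; map; _++_; allFin)
open import Data.List.Membership.Propositional using (_∈_)
open import Data.List.Relation.Unary.Any using (here; there)
open import Data.List.Membership.Propositional.Properties
  using (∈-map⁺; ∈-++⁺ˡ; ∈-++⁺ʳ; ∈-allFin)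
open import Data.Product using (Σ; _×_; _,_; proj₁)
open import Data.Sum using (_⊎_; inj₁; inj₂)
open import Data.Sum.Properties using (≡-dec)
open import Data.Empty using (⊥; ⊥-elim)
open import Relation.Nullary using (¬_; Dec; yes; no)
open import Relation.Nullary.Decidable using (map′; _×-dec_)
open import Relation.Binary.Definitions using (DecidableEquality)
import Relation.Binary.PropositionalEquality as P
open import Algebra.Bundles using (CommutativeRing)

reach-source : ∀ {n} {S : Pos n → Set} {x y} → Reach S x y → S x
reach-source (here s)     = s
reach-source (step r _ _) = reach-source r

dom-empty : ∀ {n} (π : Permutation′ (suc n)) → π ⟨$⟩ʳ F.zero P.≡ F.zero →
            ∀ x → ¬ Dom π x
dom-empty π fix x r with reach-source r
... | (j , _ , πj<π0 , _) = ℕP.n≮0 (P.subst (λ z → π ⟨$⟩ʳ j F.< z) fix πj<π0)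

pivot∉Diagram : ∀ {n} (π : Permutation′ n) k → ¬ Diagram π (π ⟨$⟩ʳ k , k)
pivot∉Diagram π k (j , _ , πj<πk , πk≡πj) = FP.<-irrefl (P.sym πk≡πj) πj<πk

diagram? : ∀ {n} (π : Permutation′ n) x → Dec (Diagram π x)
diagram? π (r , c) = FP.any? λ j →
  (c FP.<? j) ×-dec ((π ⟨$⟩ʳ j FP.<? π ⟨$⟩ʳ c) ×-dec (r FP.≟ π ⟨$⟩ʳ j))

nw? : ∀ {n} (π : Permutation′ n) x → Dec (NW π x)
nw? π (i , j) =
  map′ (λ { (a , b , d) → (a , b) , d }) (λ { ((a , b) , d) → a , b , d })
       (FP.any? λ a → FP.any? λ b →
          diagram? π (a , b) ×-dec ((i FP.≤? a) ×-dec (j FP.≤? b)))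

-- For dominant σ, no pivot (π k, k) with k > 1 of π = 1σ lies weakly
-- northwest of a box of NW(π): closure of the Young diagram D(π) under
-- moving northwest (within rows/columns ≥ 2) would put the pivot into D(π).
dominant-pivots : ∀ {m} (σ : Permutation′ m) → DominantShifted σ →
  ∀ {i j} → NW (lift₀ σ) (i , j) →
  ∀ k → lift₀ σ ⟨$⟩ʳ F.suc k F.≤ i → F.suc k F.≤ j → ⊥
dominant-pivots σ (inj₁ empty) ((a , b) , d , _) k _ _ = empty (a , b) d
dominant-pivots σ (inj₂ (_ , _ , closed)) ((a , b) , d , i≤a , j≤b) k πk≤i k≤j =
  pivot∉Diagram (lift₀ σ) (F.suc k)
    (closed a b _ _ d (s≤s z≤n) (s≤s z≤n)
            (FP.≤-trans πk≤i i≤a) (FP.≤-trans k≤j j≤b))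

allFin⊎ : ∀ n → List (Fin n ⊎ Fin n)
allFin⊎ n = map inj₁ (allFin n) ++ map inj₂ (allFin n)

allFin⊎-complete : ∀ {n} (u : Fin n ⊎ Fin n) → u ∈ allFin⊎ n
allFin⊎-complete (inj₁ i) = ∈-++⁺ˡ (∈-map⁺ inj₁ (∈-allFin i))
allFin⊎-complete {n} (inj₂ j) = ∈-++⁺ʳ (map inj₁ (allFin n)) (∈-map⁺ inj₂ (∈-allFin j))

decEq⊎ : ∀ {n} → DecidableEquality (Fin n ⊎ Fin n)
decEq⊎ = ≡-dec F._≟_ F._≟_

module Over {c ℓ} (K : ACF₀ c ℓ) where
  open ACF₀ K
  open CommutativeRing cring
  open RingOps cring
  open Geometry K
  open import Relation.Binary.Reasoning.Setoid setoid
  import Algebra.Properties.Ring as RingProperties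
  import Algebra.Properties.Group as GroupProperties
  import Algebra.Properties.CommutativeSemigroup as CSemigroupProperties
  module R  = RingProperties ring
  module G  = GroupProperties +-group
  module CS+ = CSemigroupProperties +-commutativeSemigroup
  module CS* = CSemigroupProperties *-commutativeSemigroup

  C : Set c
  C = Carrier

  no-zero-divisors : ∀ x y → x * y ≈ 0# → ¬ (x ≈ 0#) → y ≈ 0#
  no-zero-divisors x y xy≈0 x≉0 with inverse x x≉0
  ... | z , xz≈1 = begin
    y             ≈⟨ sym (*-identityˡ y) ⟩
    1# * y        ≈⟨ *-congʳ (trans (sym xz≈1) (*-comm x z)) ⟩
    (z * x) * y   ≈⟨ *-assoc z x y ⟩
    z * (x * y)   ≈⟨ *-congˡ xy≈0 ⟩
    z * 0#        ≈⟨ zeroʳ z ⟩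
    0# ∎

  cancel-distinct : ∀ x y q → x * q ≈ y * q → ¬ (x ≈ y) → q ≈ 0#
  cancel-distinct x y q xq≈yq x≉y =
    no-zero-divisors (x - y) q
      (trans (R.[y-z]x≈yx-zx q x y) (G.x≈y⇒x∙y⁻¹≈ε xq≈yq))
      (λ x-y≈0 → x≉y (G.x∙y⁻¹≈ε⇒x≈y x y x-y≈0))

  natC-+ : ∀ a b → natC (a ℕ.+ b) ≈ natC a + natC b
  natC-+ zero    b = sym (+-identityˡ _)
  natC-+ (suc a) b = trans (+-congˡ (natC-+ a b)) (sym (+-assoc 1# (natC a) (natC b)))

  -- The images 1, 2, 3, … of the positive integers: an infinite family of
  -- nonzero, pairwise distinct elements (characteristic zero).
  natPoint : ℕ → C
  natPoint k = natC (suc k)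

  natPoint-distinct : ∀ {k n} → k ℕ.< n → ¬ (natPoint k ≈ natPoint n)
  natPoint-distinct {k} {n} k<n k≈n =
    charZero d (G.identityʳ-unique (natPoint k) (natC (suc d)) sum≈k)
    where
    d = n ℕ.∸ suc k
    suc-k+suc-d : suc k ℕ.+ suc d P.≡ suc n
    suc-k+suc-d = P.cong suc (P.trans (ℕP.+-suc k d) (ℕP.m+[n∸m]≡n k<n))
    sum≈k : natPoint k + natC (suc d) ≈ natPoint k
    sum≈k = begin
      natPoint k + natC (suc d)   ≈⟨ sym (natC-+ (suc k) (suc d)) ⟩
      natC (suc k ℕ.+ suc d)      ≡⟨ P.cong natC suc-k+suc-d ⟩
      natPoint n                  ≈⟨ sym k≈n ⟩
      natPoint k ∎

  -- Univariate polynomials as coefficient lists (constant term first).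
  evalL : List C → C → C
  evalL []      t = 0#
  evalL (a ∷ f) t = a + t * evalL f t

  addL : List C → List C → List C
  addL []      g       = g
  addL (a ∷ f) []      = a ∷ f
  addL (a ∷ f) (b ∷ g) = (a + b) ∷ addL f g

  addL-eval : ∀ f g t → evalL (addL f g) t ≈ evalL f t + evalL g t
  addL-eval []      g       t = sym (+-identityˡ _)
  addL-eval (a ∷ f) []      t = sym (+-identityʳ _)
  addL-eval (a ∷ f) (b ∷ g) t = begin
    (a + b) + t * evalL (addL f g) t            ≈⟨ +-congˡ (*-congˡ (addL-eval f g t)) ⟩
    (a + b) + t * (evalL f t + evalL g t)       ≈⟨ +-congˡ (distribˡ t _ _) ⟩
    (a + b) + (t * evalL f t + t * evalL g t)   ≈⟨ CS+.interchange a b _ _ ⟩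
    (a + t * evalL f t) + (b + t * evalL g t) ∎

  scaleL : C → List C → List C
  scaleL k []      = []
  scaleL k (a ∷ f) = (k * a) ∷ scaleL k f

  scaleL-eval : ∀ k f t → evalL (scaleL k f) t ≈ k * evalL f t
  scaleL-eval k []      t = sym (zeroʳ k)
  scaleL-eval k (a ∷ f) t = begin
    k * a + t * evalL (scaleL k f) t   ≈⟨ +-congˡ (*-congˡ (scaleL-eval k f t)) ⟩
    k * a + t * (k * evalL f t)        ≈⟨ +-congˡ (CS*.x∙yz≈y∙xz t k _) ⟩
    k * a + k * (t * evalL f t)        ≈⟨ sym (distribˡ k a _) ⟩
    k * (a + t * evalL f t) ∎

  mulL : List C → List C → List C
  mulL []      g = []
  mulL (a ∷ f) g = addL (scaleL a g) (0# ∷ mulL f g)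

  mulL-eval : ∀ f g t → evalL (mulL f g) t ≈ evalL f t * evalL g t
  mulL-eval []      g t = sym (zeroˡ _)
  mulL-eval (a ∷ f) g t = begin
    evalL (addL (scaleL a g) (0# ∷ mulL f g)) t      ≈⟨ addL-eval (scaleL a g) _ t ⟩
    evalL (scaleL a g) t + (0# + t * evalL (mulL f g) t)
                                     ≈⟨ +-cong (scaleL-eval a g t) (+-identityˡ _) ⟩
    a * G + t * evalL (mulL f g) t   ≈⟨ +-congˡ (*-congˡ (mulL-eval f g t)) ⟩
    a * G + t * (evalL f t * G)      ≈⟨ +-congˡ (sym (*-assoc t _ G)) ⟩
    a * G + (t * evalL f t) * G      ≈⟨ sym (distribʳ G a _) ⟩
    (a + t * evalL f t) * G ∎
    where G = evalL g t

  -- Synthetic division: the quotient of f by (t - r).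
  quotL : List C → C → List C
  quotL []      r = []
  quotL (a ∷ f) r = addL f (scaleL r (quotL f r))

  quotL-eval : ∀ a f r t →
               evalL (quotL (a ∷ f) r) t ≈ evalL f t + r * evalL (quotL f r) t
  quotL-eval a f r t =
    trans (addL-eval f (scaleL r (quotL f r)) t) (+-congˡ (scaleL-eval r (quotL f r) t))

  -- The division identity f(t) − f(r) = (t − r) q(t), written additively.
  division-identity : ∀ f r t →
    evalL f t + r * evalL (quotL f r) t ≈ evalL f r + t * evalL (quotL f r) t
  division-identity [] r t =
    trans (+-identityˡ _) (trans (zeroʳ r) (trans (sym (zeroʳ t)) (sym (+-identityˡ _))))
  division-identity (a ∷ f) r t = begin
    (a + t * Ft) + r * E                   ≈⟨ +-congˡ (*-congˡ (trans (quotL-eval a f r t)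
                                                                    (division-identity f r t))) ⟩
    (a + t * Ft) + r * (Fr + t * Q)        ≈⟨ +-congˡ (distribˡ r Fr _) ⟩
    (a + t * Ft) + (r * Fr + r * (t * Q))  ≈⟨ +-congˡ (+-congˡ (CS*.x∙yz≈y∙xz r t Q)) ⟩
    (a + t * Ft) + (r * Fr + t * (r * Q))  ≈⟨ CS+.interchange a _ _ _ ⟩
    (a + r * Fr) + (t * Ft + t * (r * Q))  ≈⟨ +-congˡ (sym (distribˡ t Ft _)) ⟩
    (a + r * Fr) + t * (Ft + r * Q)        ≈⟨ +-congˡ (*-congˡ (sym (quotL-eval a f r t))) ⟩
    (a + r * Fr) + t * E ∎
    where
    Ft = evalL f t
    Fr = evalL f r
    Q  = evalL (quotL f r) t
    E  = evalL (quotL (a ∷ f) r) t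

  addL-length : ∀ f g n → length f ℕ.≤ n → length g ℕ.≤ n → length (addL f g) ℕ.≤ n
  addL-length []      g       n       _         g≤n       = g≤n
  addL-length (a ∷ f) []      n       f≤n       _         = f≤n
  addL-length (a ∷ f) (b ∷ g) (suc n) (s≤s f≤n) (s≤s g≤n) = s≤s (addL-length f g n f≤n g≤n)

  scaleL-length : ∀ k f → length (scaleL k f) P.≡ length f
  scaleL-length k []      = P.refl
  scaleL-length k (a ∷ f) = P.cong suc (scaleL-length k f)

  quotL-length : ∀ f r → length (quotL f r) ℕ.≤ length f ℕ.∸ 1
  quotL-length []      r = z≤n
  quotL-length (a ∷ f) r = addL-length f _ (length f) ℕP.≤-refl
    (P.subst (ℕ._≤ length f) (P.sym (scaleL-length r (quotL f r)))
       (ℕP.≤-trans (quotL-length f r) (ℕP.m∸n≤m (length f) 1)))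

  quotient-vanishes : ∀ f r s → evalL f r ≈ 0# → evalL f s ≈ 0# → ¬ (r ≈ s) →
                      evalL (quotL f r) s ≈ 0#
  quotient-vanishes f r s fr≈0 fs≈0 r≉s = cancel-distinct r s (evalL q s) rq≈sq r≉s
    where
    q = quotL f r
    rq≈sq : r * evalL q s ≈ s * evalL q s
    rq≈sq = begin
      r * evalL q s               ≈⟨ sym (+-identityˡ _) ⟩
      0# + r * evalL q s          ≈⟨ +-congʳ (sym fs≈0) ⟩
      evalL f s + r * evalL q s   ≈⟨ division-identity f r s ⟩
      evalL f r + s * evalL q s   ≈⟨ +-congʳ fr≈0 ⟩
      0# + s * evalL q s          ≈⟨ +-identityˡ _ ⟩
      s * evalL q s ∎

  -- f = (t − r) q + f(r): if f(r) = 0 and q ≡ 0 then f ≡ 0.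
  zero-quotient : ∀ f r → evalL f r ≈ 0# → (∀ s → evalL (quotL f r) s ≈ 0#) →
                  ∀ t → evalL f t ≈ 0#
  zero-quotient f r fr≈0 q≈0 t = begin
    evalL f t                  ≈⟨ sym (+-identityʳ _) ⟩
    evalL f t + 0#             ≈⟨ +-congˡ (sym (trans (*-congˡ (q≈0 t)) (zeroʳ r))) ⟩
    evalL f t + r * evalL q t  ≈⟨ division-identity f r t ⟩
    evalL f r + t * evalL q t  ≈⟨ +-cong fr≈0 (trans (*-congˡ (q≈0 t)) (zeroʳ t)) ⟩
    0# + 0#                    ≈⟨ +-identityˡ _ ⟩
    0# ∎
    where q = quotL f r

  module Roots (p : ℕ → C) (distinct : ∀ {k n} → k ℕ.< n → ¬ (p k ≈ p n)) where
    vanish-at-points : ∀ n f → length f ℕ.≤ n →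
      (∀ k → k ℕ.< n → evalL f (p k) ≈ 0#) → ∀ t → evalL f t ≈ 0#
    vanish-at-points zero    []  _     _      t = refl
    vanish-at-points (suc n) f   len≤n vanish =
      zero-quotient f (p n) root
        (vanish-at-points n (quotL f (p n)) len-q λ k k<n →
           quotient-vanishes f (p n) (p k) root
             (vanish k (ℕP.m<n⇒m<1+n k<n)) (λ e → distinct k<n (sym e)))
      where
      root = vanish n ℕP.≤-refl
      len-q = ℕP.≤-trans (quotL-length f (p n)) (ℕP.∸-monoˡ-≤ 1 len≤n)

  open Roots natPoint natPoint-distinct

  eval-cong : ∀ {I} (p : Poly I) {x y : I → C} → (∀ i → x i ≈ y i) → eval p x ≈ eval p y
  eval-cong (var i) x≈y = x≈y i
  eval-cong (con a) x≈y = refl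
  eval-cong (p ⊕ q) x≈y = +-cong (eval-cong p x≈y) (eval-cong q x≈y)
  eval-cong (p ⊛ q) x≈y = *-cong (eval-cong p x≈y) (eval-cong q x≈y)

  subst : ∀ {I J} → (I → Poly J) → Poly I → Poly J
  subst s (var i) = s i
  subst s (con a) = con a
  subst s (p ⊕ q) = subst s p ⊕ subst s q
  subst s (p ⊛ q) = subst s p ⊛ subst s q

  subst-eval : ∀ {I J} (s : I → Poly J) (p : Poly I) (x : J → C) →
               eval (subst s p) x ≈ eval p (λ i → eval (s i) x)
  subst-eval s (var i) x = refl
  subst-eval s (con a) x = refl
  subst-eval s (p ⊕ q) x = +-cong (subst-eval s p x) (subst-eval s q x)
  subst-eval s (p ⊛ q) x = *-cong (subst-eval s p x) (subst-eval s q x)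

  -- The torus (all coordinates nonzero) is Zariski dense in K^I for finite I:
  -- a polynomial vanishing on it vanishes everywhere.  One variable at a
  -- time: fixing the others, it becomes a univariate polynomial vanishing
  -- at the infinitely many points natPoint k.
  module TorusDensity {I : Set} (_≟_ : DecidableEquality I) where
    update : (I → C) → I → C → I → C
    update x v t u with u ≟ v
    ... | yes _ = t
    ... | no  _ = x u

    update-self : ∀ x v u → update x v (x v) u ≈ x u
    update-self x v u with u ≟ v
    ... | yes P.refl = refl
    ... | no  _      = refl

    toUnivariate : Poly I → (I → C) → I → List C
    toUnivariate (var u) x v with u ≟ v
    ... | yes _ = 0# ∷ 1# ∷ []
    ... | no  _ = x u ∷ []
    toUnivariate (con a) x v = a ∷ []
    toUnivariate (p ⊕ q) x v = addL (toUnivariate p x v) (toUnivariate q x v)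
    toUnivariate (p ⊛ q) x v = mulL (toUnivariate p x v) (toUnivariate q x v)

    toUnivariate-eval : ∀ p x v t → eval p (update x v t) ≈ evalL (toUnivariate p x v) t
    toUnivariate-eval (var u) x v t with u ≟ v
    ... | yes _ = sym (trans (+-identityˡ _)
                    (trans (*-congˡ (trans (+-congˡ (zeroʳ t)) (+-identityʳ 1#))) (*-identityʳ t)))
    ... | no  _ = sym (trans (+-congˡ (zeroʳ t)) (+-identityʳ _))
    toUnivariate-eval (con a) x v t = sym (trans (+-congˡ (zeroʳ t)) (+-identityʳ _))
    toUnivariate-eval (p ⊕ q) x v t =
      trans (+-cong (toUnivariate-eval p x v t) (toUnivariate-eval q x v t))
            (sym (addL-eval (toUnivariate p x v) (toUnivariate q x v) t))
    toUnivariate-eval (p ⊛ q) x v t =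
      trans (*-cong (toUnivariate-eval p x v t) (toUnivariate-eval q x v t))
            (sym (mulL-eval (toUnivariate p x v) (toUnivariate q x v) t))

    ZerosAmong : List I → (I → C) → Set ℓ
    ZerosAmong vs x = ∀ u → u ∈ vs ⊎ ¬ (x u ≈ 0#)

    update-nonzero : ∀ x v vs t → ¬ (t ≈ 0#) → ZerosAmong (v ∷ vs) x →
                     ZerosAmong vs (update x v t)
    update-nonzero x v vs t t≉0 zeros u with u ≟ v | zeros u
    ... | yes _   | _                  = inj₂ t≉0
    ... | no  u≢v | inj₁ (here u≡v)    = ⊥-elim (u≢v u≡v)
    ... | no  _   | inj₁ (there u∈vs)  = inj₁ u∈vs
    ... | no  _   | inj₂ xu≉0          = inj₂ xu≉0

    vanish-off-zeros : (q : Poly I) → (∀ x → (∀ u → ¬ (x u ≈ 0#)) → eval q x ≈ 0#) →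
                       ∀ vs x → ZerosAmong vs x → eval q x ≈ 0#
    vanish-off-zeros q onTorus [] x zeros = onTorus x λ u → nonzero (zeros u)
      where
      nonzero : ∀ {u} → u ∈ [] ⊎ ¬ (x u ≈ 0#) → ¬ (x u ≈ 0#)
      nonzero (inj₁ ())
      nonzero (inj₂ xu≉0) = xu≉0
    vanish-off-zeros q onTorus (v ∷ vs) x zeros = begin
      eval q x                         ≈⟨ eval-cong q (λ u → sym (update-self x v u)) ⟩
      eval q (update x v (x v))        ≈⟨ toUnivariate-eval q x v (x v) ⟩
      evalL (toUnivariate q x v) (x v) ≈⟨ vanish-at-points (length f) f ℕP.≤-refl
                                            (λ k _ → at-nonzero (natPoint k) (charZero k)) (x v) ⟩
      0# ∎
      where
      f = toUnivariate q x v
      at-nonzero : ∀ t → ¬ (t ≈ 0#) → evalL f t ≈ 0#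
      at-nonzero t t≉0 = trans (sym (toUnivariate-eval q x v t))
        (vanish-off-zeros q onTorus vs (update x v t) (update-nonzero x v vs t t≉0 zeros))

    torus-dense : (vars : List I) → (∀ u → u ∈ vars) →
                  (q : Poly I) → (∀ x → (∀ u → ¬ (x u ≈ 0#)) → eval q x ≈ 0#) →
                  ∀ x → eval q x ≈ 0#
    torus-dense vars complete q onTorus x =
      vanish-off-zeros q onTorus vars x (λ u → inj₁ (complete u))

  sumF-cong : ∀ {k} (f g : Fin k → C) → (∀ i → f i ≈ g i) → sumF f ≈ sumF g
  sumF-cong {zero}  f g f≈g = refl
  sumF-cong {suc k} f g f≈g =
    +-cong (f≈g F.zero) (sumF-cong (λ i → f (F.suc i)) (λ i → g (F.suc i)) (λ i → f≈g (F.suc i)))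

  sumF-zero : ∀ {k} (f : Fin k → C) → (∀ i → f i ≈ 0#) → sumF f ≈ 0#
  sumF-zero {zero}  f f≈0 = refl
  sumF-zero {suc k} f f≈0 =
    trans (+-cong (f≈0 F.zero) (sumF-zero (λ i → f (F.suc i)) (λ i → f≈0 (F.suc i))))
          (+-identityˡ 0#)

  sumF-single : ∀ {k} (f : Fin k → C) (l₀ : Fin k) → (∀ l → ¬ (l P.≡ l₀) → f l ≈ 0#) →
                sumF f ≈ f l₀
  sumF-single {suc k} f F.zero others =
    trans (+-congˡ (sumF-zero (λ i → f (F.suc i)) (λ i → others (F.suc i) (λ ()))))
          (+-identityʳ _)
  sumF-single {suc k} f (F.suc l₀) others =
    trans (+-cong (others F.zero (λ ()))
                  (sumF-single (λ i → f (F.suc i)) l₀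
                     (λ l l≢l₀ → others (F.suc l) (λ e → l≢l₀ (FP.suc-injective e)))))
          (+-identityˡ _)

  mul-permMat : ∀ {n} (π : Permutation′ n) (L : Mat n) i k →
                (L · permMat π) i k ≈ L i (π ⟨$⟩ʳ k)
  mul-permMat π L i k =
    trans (sumF-single (λ l → L i l * permMat π l k) (π ⟨$⟩ʳ k) off-pivot)
          (trans (*-congˡ on-pivot) (*-identityʳ _))
    where
    on-pivot : permMat π (π ⟨$⟩ʳ k) k ≈ 1#
    on-pivot with π ⟨$⟩ʳ k F.≟ π ⟨$⟩ʳ k
    ... | yes _ = refl
    ... | no  πk≢πk = ⊥-elim (πk≢πk P.refl)
    off-pivot : ∀ l → ¬ (l P.≡ π ⟨$⟩ʳ k) → L i l * permMat π l k ≈ 0#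
    off-pivot l l≢πk with π ⟨$⟩ʳ k F.≟ l
    ... | yes πk≡l = ⊥-elim (l≢πk (P.sym πk≡l))
    ... | no  _    = zeroʳ _

  -- Entry (i,j) of L P_π U, L lower and U upper triangular: the term k
  -- vanishes unless π k ≤ i and k ≤ j; if only k₀ survives, it is the entry.
  cell-single-term : ∀ {n} (π : Permutation′ n) (L U : Mat n) →
    (∀ i j → i F.< j → L i j ≈ 0#) → (∀ i j → j F.< i → U i j ≈ 0#) →
    ∀ {i j} k₀ → (∀ k → ¬ (k P.≡ k₀) → π ⟨$⟩ʳ k F.≤ i → k F.≤ j → ⊥) →
    ((L · permMat π) · U) i j ≈ L i (π ⟨$⟩ʳ k₀) * U k₀ j
  cell-single-term π L U lower upper {i} {j} k₀ only-k₀ =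
    trans (sumF-cong _ (λ k → L i (π ⟨$⟩ʳ k) * U k j) (λ k → *-congʳ (mul-permMat π L i k)))
          (sumF-single (λ k → L i (π ⟨$⟩ʳ k) * U k j) k₀ term)
    where
    term : ∀ k → ¬ (k P.≡ k₀) → L i (π ⟨$⟩ʳ k) * U k j ≈ 0#
    term k k≢k₀ with π ⟨$⟩ʳ k FP.≤? i | k FP.≤? j
    ... | no πk≰i | _      = trans (*-congʳ (lower i _ (ℕP.≰⇒> πk≰i))) (zeroˡ _)
    ... | yes _   | no k≰j = trans (*-congˡ (upper k j (ℕP.≰⇒> k≰j))) (zeroʳ _)
    ... | yes πk≤i | yes k≤j = ⊥-elim (only-k₀ k k≢k₀ πk≤i k≤j)

  identity : ∀ {n} → Mat n
  identity i j with i F.≟ j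
  ... | yes _ = 1#
  ... | no  _ = 0#

  firstColumn : ∀ {n} → (Fin (suc n) → C) → Mat (suc n)
  firstColumn a i         F.zero    = a i
  firstColumn a F.zero    (F.suc j) = 0#
  firstColumn a (F.suc i) (F.suc j) = identity i j

  transpose : ∀ {n} → Mat n → Mat n
  transpose A i j = A j i

  firstColumn-lower : ∀ {n} (a : Fin (suc n) → C) → ¬ (a F.zero ≈ 0#) → LowerInv (firstColumn a)
  firstColumn-lower a a₁≉0 = above-diagonal , diagonal
    where
    above-diagonal : ∀ i j → i F.< j → firstColumn a i j ≈ 0#
    above-diagonal F.zero    (F.suc j) _ = refl
    above-diagonal (F.suc i) (F.suc j) i<j with i F.≟ j
    ... | yes P.refl = ⊥-elim (ℕP.<-irrefl P.refl i<j)
    ... | no  _      = refl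
    diagonal : ∀ i → ¬ (firstColumn a i i ≈ 0#)
    diagonal F.zero = a₁≉0
    diagonal (F.suc i) with i F.≟ i
    ... | yes _ = nontrivial
    ... | no  i≢i = ⊥-elim (i≢i P.refl)

  transpose-lower : ∀ {n} (A : Mat n) → LowerInv A → UpperInv (transpose A)
  transpose-lower A (above , diagonal) = (λ i j j<i → above j i j<i) , diagonal

  module Dominant {m} (σ : Permutation′ m) (dominant : DominantShifted σ) where
    π = lift₀ σ

    cell-on-NW : ∀ (L U : Mat (suc m)) → LowerInv L → UpperInv U →
                 ∀ {i j} → NW π (i , j) → ((L · permMat π) · U) i j ≈ L i F.zero * U F.zero j
    cell-on-NW L U (lower , _) (upper , _) ij∈NW =
      cell-single-term π L U lower upper F.zero only-first
      where
      only-first : ∀ k → ¬ (k P.≡ F.zero) → _ → _ → ⊥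
      only-first F.zero    k≢0 _ _ = k≢0 P.refl
      only-first (F.suc k) _       = dominant-pivots σ dominant ij∈NW k

    L⊆NW : ∀ x → Lset π x → NW π x
    L⊆NW x = proj₁

    NW⊆L : ∀ x → NW π x → Lset π x
    NW⊆L x x∈NW = x∈NW , dom-empty π P.refl x

    -- The generic point: the indicator matrix of NW(π).
    y : Pos (suc m) → C
    y (i , j) with nw? π (i , j)
    ... | yes _ = 1#
    ... | no  _ = 0#

    y-on : ∀ {i j} → NW π (i , j) → y (i , j) ≈ 1#
    y-on {i} {j} ij∈NW with nw? π (i , j)
    ... | yes _ = refl
    ... | no  ij∉NW = ⊥-elim (ij∉NW ij∈NW)

    y-off : ∀ {i j} → ¬ NW π (i , j) → y (i , j) ≈ 0#
    y-off {i} {j} ij∉NW with nw? π (i , j)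
    ... | yes ij∈NW = ⊥-elim (ij∉NW ij∈NW)
    ... | no  _ = refl

    -- The orbit point (a_i y_ij b_j) is the projection of the cell point
    -- L P_π U with L = firstColumn a, U = transpose (firstColumn b).
    orbit⊆Y : ∀ w → Orbit y w → Y π w
    orbit⊆Y w (a , b , a≉0 , b≉0 , w≈ayb) = M , M∈closure , on-L , off-L
      where
      L = firstColumn a
      U = transpose (firstColumn b)
      L-lower = firstColumn-lower a (a≉0 F.zero)
      U-upper = transpose-lower (firstColumn b) (firstColumn-lower b (b≉0 F.zero))
      M : Pos (suc m) → C
      M (i , j) = ((L · permMat π) · U) i j
      M∈closure : closure (Cell π) M
      M∈closure p vanishes = vanishes M (L , U , L-lower , U-upper , λ i j → refl)
      on-L : ∀ x → Lset π x → w x ≈ M x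
      on-L (i , j) (ij∈NW , _) = begin
        w (i , j)                ≈⟨ w≈ayb i j ⟩
        (a i * y (i , j)) * b j  ≈⟨ *-congʳ (trans (*-congˡ (y-on ij∈NW)) (*-identityʳ _)) ⟩
        a i * b j                ≈⟨ sym (cell-on-NW L U L-lower U-upper ij∈NW) ⟩
        M (i , j) ∎
      off-L : ∀ x → ¬ Lset π x → w x ≈ 0#
      off-L (i , j) ij∉L = begin
        w (i , j)                ≈⟨ w≈ayb i j ⟩
        (a i * y (i , j)) * b j  ≈⟨ *-congʳ (trans (*-congˡ (y-off (λ ij∈NW → ij∉L (NW⊆L _ ij∈NW)))) (zeroʳ _)) ⟩
        0# * b j                 ≈⟨ zeroˡ _ ⟩
        0# ∎

    y-in-own-orbit : Orbit y y
    y-in-own-orbit = (λ _ → 1#) , (λ _ → 1#) , (λ _ → nontrivial) , (λ _ → nontrivial) ,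
                     λ i j → sym (trans (*-identityʳ _) (*-identityˡ _))

    restrictNW : Pos (suc m) → Poly (Pos (suc m))
    restrictNW (i , j) with nw? π (i , j)
    ... | yes _ = var (i , j)
    ... | no  _ = con 0#

    outerNW : Pos (suc m) → Poly (Fin (suc m) ⊎ Fin (suc m))
    outerNW (i , j) with nw? π (i , j)
    ... | yes _ = var (inj₁ i) ⊛ var (inj₂ j)
    ... | no  _ = con 0#

    Y-restrict : ∀ w → Y π w → Σ (Pos (suc m) → C) λ M →
                 closure (Cell π) M × (∀ x → w x ≈ eval (restrictNW x) M)
    Y-restrict w (M , M∈closure , on-L , off-L) = M , M∈closure , agree
      where
      agree : ∀ x → w x ≈ eval (restrictNW x) M
      agree (i , j) with nw? π (i , j)
      ... | yes ij∈NW = on-L (i , j) (NW⊆L _ ij∈NW)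
      ... | no  ij∉NW = off-L (i , j) (λ ij∈L → ij∉NW (L⊆NW _ ij∈L))

    rankOneFactors : Mat (suc m) → Mat (suc m) → Fin (suc m) ⊎ Fin (suc m) → C
    rankOneFactors L U (inj₁ i) = L i F.zero
    rankOneFactors L U (inj₂ j) = U F.zero j

    cell-restrict : ∀ M → (cell : Cell π M) → let (L , U , _) = cell in
      ∀ x → eval (restrictNW x) M ≈ eval (outerNW x) (rankOneFactors L U)
    cell-restrict M (L , U , L-lower , U-upper , M≈LPU) (i , j) with nw? π (i , j)
    ... | yes ij∈NW = trans (M≈LPU i j) (cell-on-NW L U L-lower U-upper ij∈NW)
    ... | no  _     = refl

    outer-in-orbit : ∀ ρ → (∀ u → ¬ (ρ u ≈ 0#)) → Orbit y (λ x → eval (outerNW x) ρ)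
    outer-in-orbit ρ ρ≉0 = (λ i → ρ (inj₁ i)) , (λ j → ρ (inj₂ j)) ,
                           (λ i → ρ≉0 (inj₁ i)) , (λ j → ρ≉0 (inj₂ j)) , entry
      where
      entry : ∀ i j → eval (outerNW (i , j)) ρ ≈ (ρ (inj₁ i) * y (i , j)) * ρ (inj₂ j)
      entry i j with nw? π (i , j)
      ... | yes _ = sym (*-congʳ (*-identityʳ _))
      ... | no  _ = sym (trans (*-congʳ (zeroʳ _)) (zeroˡ _))

    -- A polynomial vanishing on the orbit of y vanishes on Y_π: pulled back
    -- along (a, b) ↦ (a_i b_j) it vanishes on the torus, hence everywhere,
    -- hence on every cell point, hence on the closure.
    Y⊆orbit-closure : ∀ w → Y π w → closure (Orbit y) w
    Y⊆orbit-closure w w∈Y p p-on-orbit with Y-restrict w w∈Y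
    ... | M , M∈closure , w≈M = begin
      eval p w                                ≈⟨ eval-cong p w≈M ⟩
      eval p (λ x → eval (restrictNW x) M)    ≈⟨ sym (subst-eval restrictNW p M) ⟩
      eval (subst restrictNW p) M             ≈⟨ M∈closure (subst restrictNW p) on-cells ⟩
      0# ∎
      where
      open TorusDensity decEq⊎
      pulled-back-zero : ∀ ρ → eval (subst outerNW p) ρ ≈ 0#
      pulled-back-zero = torus-dense (allFin⊎ (suc m)) allFin⊎-complete (subst outerNW p)
        λ ρ ρ≉0 → trans (subst-eval outerNW p ρ) (p-on-orbit _ (outer-in-orbit ρ ρ≉0))
      on-cells : ∀ M′ → Cell π M′ → eval (subst restrictNW p) M′ ≈ 0#
      on-cells M′ cell@(L , U , _) = begin
        eval (subst restrictNW p) M′             ≈⟨ subst-eval restrictNW p M′ ⟩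
        eval p (λ x → eval (restrictNW x) M′)    ≈⟨ eval-cong p (cell-restrict M′ cell) ⟩
        eval p (λ x → eval (outerNW x) ρ)        ≈⟨ sym (subst-eval outerNW p ρ) ⟩
        eval (subst outerNW p) ρ                 ≈⟨ pulled-back-zero ρ ⟩
        0# ∎
        where ρ = rankOneFactors L U

    toric : Toric π
    toric = y , orbit⊆Y y y-in-own-orbit , orbit⊆Y , Y⊆orbit-closure

mainTheorem6 : ∀ {c ℓ : Level} (K : ACF₀ c ℓ) (m : ℕ) (σ : Permutation′ m) →
    DominantShifted σ → Geometry.Toric K (lift₀ σ)
mainTheorem6 K m σ dominant = Over.Dominant.toric K σ dominant
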